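{- Let $E/\mathbb{Q}$ be an elliptic curve. Then: (i) if $E$ has good reduction at $2$, then $\operatorname{rmm}(E)=R_i$ with $i\in\{2,4,6,7,8,9,10,11,12\}$; if $E$ has good reduction at $3$, then $\operatorname{rmm}(E)=R_i$ with $i\in\{1,\dots,12\}$; (ii) if $E$ has multiplicative reduction at $2$, then $\operatorname{rmm}(E)=R_i$ with $i\in\{7,8,9,10,11,12\}$; if $E$ has multiplicative reduction at $3$, then $\operatorname{rmm}(E)=R_i$ with $i\in\{3,4,5,6,7,8,11,12\}$; (iii) if $E$ has additive reduction at $2$, then $\operatorname{rmm}(E)=R_i$ with $i\in\{1,3,5\}$; if $E$ has additive reduction at $3$, then $\operatorname{rmm}(E)=R_i$ with $i\in\{1,2,9,10\}$.
   Context: For a Weierstrass model $y^2+a_1xy+a_3y=x^3+a_2x^2+a_4x+a_6$ set $c_4=a_1^4+8a_1^2a_2-24a_1a_3+16a_2^2-48a_4$, $c_6=-(a_1^2+4a_2)^3+36(a_1^2+4a_2)(2a_4+a_1a_3)-216(a_3^2+4a_6)$, $\Delta=(c_4^3-c_6^2)/1728$. A global minimal model of $E/\mathbb{Q}$ is an integral Weierstrass model $\mathbb{Q}$-isomorphic to $E$ whose discriminant has minimal absolute value; let $c_4,c_6,\Delta$ be its invariants. For a prime $p$, $E$ has good reduction at $p$ if $p\nmid\Delta$, multiplicative reduction at $p$ if $p\mid\Delta$ and $p\nmid c_4$, and additive reduction at $p$ if $p\mid\gcd(c_4,\Delta)$. The reduced minimal model of $E$ is the unique global minimal model with $a_1,a_3\in\{0,1\}$,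 $a_2\in\{ -1,0,1\}$, and $\operatorname{rmm}(E)=(a_1,a_2,a_3)$ for it. $R_1=(0,0,0)$, $R_2=(0,0,1)$, $R_3=(0,-1,0)$, $R_4=(0,-1,1)$, $R_5=(0,1,0)$, $R_6=(0,1,1)$, $R_7=(1,0,0)$, $R_8=(1,0,1)$, $R_9=(1,-1,0)$, $R_{10}=(1,-1,1)$, $R_{11}=(1,1,0)$, $R_{12}=(1,1,1)$. -}

module Defs where

open import Data.Nat using (ℕ)
open import Data.Integer using (ℤ; +_; -[1+_]; _+_; _-_; _*_; _^_; -_; ∣_∣)
open import Data.Integer.DivMod using (_/ℕ_)
open import Data.Integer.Divisibility using (_∣_)
import Data.Nat as ℕ
import Data.Rational as ℚ
open import Data.Rational using (ℚ; 0ℚ)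
open import Data.Product using (Σ; _×_; _,_)
open import Data.List using (List; []; _∷_)
open import Relation.Binary.PropositionalEquality using (_≡_)
open import Relation.Nullary using (¬_)

-- An integral Weierstrass model y^2 + a1 xy + a3 y = x^3 + a2 x^2 + a4 x + a6.
record Weierstrass : Set where
  constructor mkW
  field
    a₁ a₂ a₃ a₄ a₆ : ℤ
open Weierstrass public

c₄ : Weierstrass → ℤ
c₄ (mkW a1 a2 a3 a4 a6) =
  a1 ^ 4 + + 8 * a1 ^ 2 * a2 - + 24 * a1 * a3 + + 16 * a2 ^ 2 - + 48 * a4

c₆ : Weierstrass → ℤ
c₆ (mkW a1 a2 a3 a4 a6) =
  - (a1 ^ 2 + + 4 * a2) ^ 3
  + + 36 * (a1 ^ 2 + + 4 * a2) * (+ 2 * a4 + a1 * a3)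
  - + 216 * (a3 ^ 2 + + 4 * a6)

-- Δ = (c4^3 - c6^2) / 1728 (the division is exact for integral models).
Δ : Weierstrass → ℤ
Δ W = (c₄ W ^ 3 - c₆ W ^ 2) /ℕ 1728

⟦_⟧ : ℤ → ℚ
⟦ x ⟧ = x ℚ./ 1

-- W' is obtained from W by the standard change of variables
-- x = u^2 x' + r, y = u^3 y' + s u^2 x' + t, with u,r,s,t ∈ ℚ, u ≠ 0
-- (Silverman, Table 3.1); these are exactly the ℚ-isomorphisms of models.
QIso : Weierstrass → Weierstrass → Set
QIso W W' =
  Σ ℚ λ u → Σ ℚ λ r → Σ ℚ λ s → Σ ℚ λ t →
    ¬ (u ≡ 0ℚ)
  × (u ℚ.* ⟦ a₁ W' ⟧ ≡ ⟦ a₁ W ⟧ ℚ.+ 2ℚ ℚ.* s)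
  × (u ℚ.* u ℚ.* ⟦ a₂ W' ⟧ ≡ ⟦ a₂ W ⟧ ℚ.- s ℚ.* ⟦ a₁ W ⟧ ℚ.+ 3ℚ ℚ.* r ℚ.- s ℚ.* s)
  × (u ℚ.* u ℚ.* u ℚ.* ⟦ a₃ W' ⟧ ≡ ⟦ a₃ W ⟧ ℚ.+ r ℚ.* ⟦ a₁ W ⟧ ℚ.+ 2ℚ ℚ.* t)
  × (u ℚ.* u ℚ.* u ℚ.* u ℚ.* ⟦ a₄ W' ⟧
       ≡ ⟦ a₄ W ⟧ ℚ.- s ℚ.* ⟦ a₃ W ⟧ ℚ.+ 2ℚ ℚ.* r ℚ.* ⟦ a₂ W ⟧
         ℚ.- (t ℚ.+ r ℚ.* s) ℚ.* ⟦ a₁ W ⟧ ℚ.+ 3ℚ ℚ.* r ℚ.* r ℚ.- 2ℚ ℚ.* s ℚ.* t)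
  × (u ℚ.* u ℚ.* u ℚ.* u ℚ.* u ℚ.* u ℚ.* ⟦ a₆ W' ⟧
       ≡ ⟦ a₆ W ⟧ ℚ.+ r ℚ.* ⟦ a₄ W ⟧ ℚ.+ r ℚ.* r ℚ.* ⟦ a₂ W ⟧ ℚ.+ r ℚ.* r ℚ.* r
         ℚ.- t ℚ.* ⟦ a₃ W ⟧ ℚ.- t ℚ.* t ℚ.- r ℚ.* t ℚ.* ⟦ a₁ W ⟧)
  where
  2ℚ 3ℚ : ℚ
  2ℚ = + 2 ℚ./ 1
  3ℚ = + 3 ℚ./ 1

IsElliptic : Weierstrass → Set
IsElliptic W = ¬ (Δ W ≡ + 0)

IsGlobalMinimal : Weierstrass → Set
IsGlobalMinimal W = (W' : Weierstrass) → QIso W W' → ∣ Δ W ∣ ℕ.≤ ∣ Δ W' ∣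

IsReduced : Weierstrass → Set
IsReduced W =
  (a₁ W ≡ + 0 ⊎′ a₁ W ≡ + 1)
  × (a₂ W ≡ -[1+ 0 ] ⊎′ (a₂ W ≡ + 0 ⊎′ a₂ W ≡ + 1))
  × (a₃ W ≡ + 0 ⊎′ a₃ W ≡ + 1)
  where open import Data.Sum using () renaming (_⊎_ to _⊎′_)

IsReducedMinimalModel : Weierstrass → Set
IsReducedMinimalModel W = IsElliptic W × IsGlobalMinimal W × IsReduced W

Triple : Set
Triple = ℤ × ℤ × ℤ

rmm : Weierstrass → Triple
rmm W = a₁ W , a₂ W , a₃ W

R₁ R₂ R₃ R₄ R₅ R₆ R₇ R₈ R₉ R₁₀ R₁₁ R₁₂ : Triple
R₁  = + 0 , + 0 , + 0
R₂  = + 0 , + 0 , + 1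
R₃  = + 0 , -[1+ 0 ] , + 0
R₄  = + 0 , -[1+ 0 ] , + 1
R₅  = + 0 , + 1 , + 0
R₆  = + 0 , + 1 , + 1
R₇  = + 1 , + 0 , + 0
R₈  = + 1 , + 0 , + 1
R₉  = + 1 , -[1+ 0 ] , + 0
R₁₀ = + 1 , -[1+ 0 ] , + 1
R₁₁ = + 1 , + 1 , + 0
R₁₂ = + 1 , + 1 , + 1

GoodAt : ℕ → Weierstrass → Set
GoodAt p W = ¬ (+ p ∣ Δ W)

MultiplicativeAt : ℕ → Weierstrass → Set
MultiplicativeAt p W = (+ p ∣ Δ W) × ¬ (+ p ∣ c₄ W)

AdditiveAt : ℕ → Weierstrass → Set
AdditiveAt p W = (+ p ∣ c₄ W) × (+ p ∣ Δ W)

{-# OPTIONS --safe #-}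
-- With Silverman's b₂ = a₁² + 4a₂, b₄ = 2a₄ + a₁a₃, b₆ = a₃² + 4a₆ and b₈ one has
-- c₄ = b₂² − 24b₄, so for p ∈ {2, 3} we get p ∣ c₄ iff p ∣ b₂², a condition on (a₁, a₂)
-- alone; and Δ = −b₂²b₈ − 8b₄³ − 27b₆² + 9b₂b₄b₆, which is ≡ a₃⁴ mod 2 when a₁ = 0.
-- Each reduction type therefore forces a decidable condition on rmm W, and filtering the
-- twelve reduced triples by that condition gives exactly the listed Rᵢ.
module Submission where

open import Defs
open import Data.Product using (_×_)
open import Data.List using (_∷_; [])
open import Data.List.Membership.Propositional using (_∈_)

open import Data.Integer
open import Data.Integer.DivMod using (_/ℕ_; _%ℕ_; a≡a%ℕn+[a/ℕn]*n; n%ℕd<d)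
open import Data.Integer.Divisibility using (_∣_)
import Data.Integer.Divisibility.Signed as Signed
open import Data.Integer.Properties using (_≟_; *-cancelʳ-≡; +-identityˡ; pos-*)
open import Data.Integer.Solver using (module +-*-Solver)
open import Data.List using (List; filter; cartesianProduct)
open import Data.List.Membership.Propositional.Properties using (∈-filter⁺; ∈-cartesianProduct⁺)
open import Data.List.Relation.Unary.Any using (here; there)
import Data.Nat as ℕ
import Data.Nat.Divisibility as ℕ
open import Data.Product using (_,_)
open import Data.Sum using (_⊎_; [_,_]′)
open import Function using (_∘_; _⇔_; mk⇔; Equivalence)
open import Relation.Binary.PropositionalEquality
open import Relation.Nullary using (Dec; ¬_; ¬?; _×-dec_; _→-dec_; contradiction)
open import Relation.Unary using (Decidable)

open +-*-Solver
open ≡-Reasoning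
open Equivalence using (to; from)

infix 4 _≡_mod_

record _≡_mod_ (a b : ℤ) (n : ℕ.ℕ) : Set where
  constructor congruent
  field
    quotient : ℤ
    equality : a ≡ b + quotient * + n

∣-resp-≡-mod : ∀ {a b n} → a ≡ b mod n → (+ n ∣ a) ⇔ (+ n ∣ b)
∣-resp-≡-mod {b = b} {n} (congruent k refl) = mk⇔
  (λ n∣a → Signed.∣⇒∣ᵤ (Signed.∣m+n∣n⇒∣m {m = b} (Signed.∣ᵤ⇒∣ {i = b + k * + n} n∣a) n∣kn))
  (λ n∣b → Signed.∣⇒∣ᵤ (Signed.∣m∣n⇒∣m+n (Signed.∣ᵤ⇒∣ {i = b} n∣b) n∣kn))
  where
  n∣kn : + n Signed.∣ k * + n
  n∣kn = Signed.∣n⇒∣m*n k Signed.∣-refl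

infix 4 _∣?_

_∣?_ : ∀ m x → Dec (m ∣ x)
m ∣? x = ∣ m ∣ ℕ.∣? ∣ x ∣

∣∧<⇒≡0 : ∀ {m} n → m ℕ.∣ n → n ℕ.< m → n ≡ 0
∣∧<⇒≡0 ℕ.zero    _   _   = refl
∣∧<⇒≡0 (ℕ.suc n) m∣n n<m = contradiction m∣n (ℕ.>⇒∤ n<m)

/ℕ-exact : ∀ x y d .{{_ : ℕ.NonZero d}} → x ≡ y * + d → x /ℕ d ≡ y
/ℕ-exact x y d x≡yd = *-cancelʳ-≡ q y (+ d) (begin
    q * + d        ≡⟨ +-identityˡ (q * + d) ⟨
    + 0 + q * + d  ≡⟨ cong (λ r → + r + q * + d) r≡0 ⟨
    + r + q * + d  ≡⟨ a≡a%ℕn+[a/ℕn]*n x d ⟨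
    x              ≡⟨ x≡yd ⟩
    y * + d        ∎)
  where
  q = x /ℕ d
  r = x %ℕ d
  r≡[y-q]d : + r ≡ (y - q) * + d
  r≡[y-q]d = begin
    + r                      ≡⟨ solve 3 (λ r q d → r := r :+ q :* d :- q :* d) refl (+ r) q (+ d) ⟩
    + r + q * + d - q * + d  ≡⟨ cong (_- q * + d) (trans (sym (a≡a%ℕn+[a/ℕn]*n x d)) x≡yd) ⟩
    y * + d - q * + d        ≡⟨ solve 3 (λ y q d → y :* d :- q :* d := (y :- q) :* d) refl y q (+ d) ⟩
    (y - q) * + d            ∎
  r≡0 : r ≡ 0
  r≡0 = ∣∧<⇒≡0 r (Signed.∣⇒∣ᵤ (Signed.divides (y - q) r≡[y-q]d)) (n%ℕd<d x d)

-- b₂ is taken as a function of rmm W since it only involves a₁ and a₂.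
b₂ : Triple → ℤ
b₂ (a₁ , a₂ , _) = a₁ ^ 2 + + 4 * a₂

b₄ b₆ b₈ Δᵇ : Weierstrass → ℤ
b₄ W = + 2 * a₄ W + a₁ W * a₃ W
b₆ W = a₃ W ^ 2 + + 4 * a₆ W
b₈ W = a₁ W ^ 2 * a₆ W + + 4 * a₂ W * a₆ W - a₁ W * a₃ W * a₄ W + a₂ W * a₃ W ^ 2 - a₄ W ^ 2
Δᵇ W = - b₂ (rmm W) ^ 2 * b₈ W - + 8 * b₄ W ^ 3 - + 27 * b₆ W ^ 2 + + 9 * b₂ (rmm W) * b₄ W * b₆ W

c₄≡b₂²-24b₄ : ∀ W → c₄ W ≡ b₂ (rmm W) ^ 2 - + 24 * b₄ W
c₄≡b₂²-24b₄ (mkW a₁ a₂ a₃ a₄ _) = solve 4 (λ a₁ a₂ a₃ a₄ →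
    a₁ :^ 4 :+ con (+ 8) :* a₁ :^ 2 :* a₂ :- con (+ 24) :* a₁ :* a₃ :+ con (+ 16) :* a₂ :^ 2 :- con (+ 48) :* a₄
  := (a₁ :^ 2 :+ con (+ 4) :* a₂) :^ 2 :- con (+ 24) :* (con (+ 2) :* a₄ :+ a₁ :* a₃))
  refl a₁ a₂ a₃ a₄

c₆≡-b₂³+36b₂b₄-216b₆ : ∀ W → c₆ W ≡ - b₂ (rmm W) ^ 3 + + 36 * b₂ (rmm W) * b₄ W - + 216 * b₆ W
c₆≡-b₂³+36b₂b₄-216b₆ W = refl

4b₈+b₄²≡b₂b₆ : ∀ W → + 4 * b₈ W + b₄ W ^ 2 ≡ b₂ (rmm W) * b₆ W
4b₈+b₄²≡b₂b₆ (mkW a₁ a₂ a₃ a₄ a₆) = solve 5 (λ a₁ a₂ a₃ a₄ a₆ →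
    con (+ 4) :* (a₁ :^ 2 :* a₆ :+ con (+ 4) :* a₂ :* a₆ :- a₁ :* a₃ :* a₄ :+ a₂ :* a₃ :^ 2 :- a₄ :^ 2)
      :+ (con (+ 2) :* a₄ :+ a₁ :* a₃) :^ 2
  := (a₁ :^ 2 :+ con (+ 4) :* a₂) :* (a₃ :^ 2 :+ con (+ 4) :* a₆))
  refl a₁ a₂ a₃ a₄ a₆

-- As polynomials in independent b's the identity 1728Δ = c₄³ − c₆² fails; it holds
-- modulo the relation 4b₈ + b₄² = b₂b₆.
c₄³-c₆²≡1728Δᵇ+432b₂²[4b₈+b₄²-b₂b₆] : ∀ b₂ b₄ b₆ b₈ →
  (b₂ ^ 2 - + 24 * b₄) ^ 3 - (- b₂ ^ 3 + + 36 * b₂ * b₄ - + 216 * b₆) ^ 2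
    ≡ (- b₂ ^ 2 * b₈ - + 8 * b₄ ^ 3 - + 27 * b₆ ^ 2 + + 9 * b₂ * b₄ * b₆) * + 1728
      + + 432 * b₂ ^ 2 * (+ 4 * b₈ + b₄ ^ 2 - b₂ * b₆)
c₄³-c₆²≡1728Δᵇ+432b₂²[4b₈+b₄²-b₂b₆] = solve 4 (λ b₂ b₄ b₆ b₈ →
    (b₂ :^ 2 :- con (+ 24) :* b₄) :^ 3 :- (:- b₂ :^ 3 :+ con (+ 36) :* b₂ :* b₄ :- con (+ 216) :* b₆) :^ 2
  := (:- b₂ :^ 2 :* b₈ :- con (+ 8) :* b₄ :^ 3 :- con (+ 27) :* b₆ :^ 2 :+ con (+ 9) :* b₂ :* b₄ :* b₆) :* con (+ 1728)
      :+ con (+ 432) :* b₂ :^ 2 :* (con (+ 4) :* b₈ :+ b₄ :^ 2 :- b₂ :* b₆))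
  refl

c₄³-c₆²≡1728Δᵇ : ∀ W → c₄ W ^ 3 - c₆ W ^ 2 ≡ Δᵇ W * + 1728
c₄³-c₆²≡1728Δᵇ W = begin
  c₄ W ^ 3 - c₆ W ^ 2
    ≡⟨ cong (λ c → c ^ 3 - c₆ W ^ 2) (c₄≡b₂²-24b₄ W) ⟩
  (β ^ 2 - + 24 * b₄ W) ^ 3 - c₆ W ^ 2
    ≡⟨ cong (λ c → (β ^ 2 - + 24 * b₄ W) ^ 3 - c ^ 2) (c₆≡-b₂³+36b₂b₄-216b₆ W) ⟩
  (β ^ 2 - + 24 * b₄ W) ^ 3 - (- β ^ 3 + + 36 * β * b₄ W - + 216 * b₆ W) ^ 2
    ≡⟨ c₄³-c₆²≡1728Δᵇ+432b₂²[4b₈+b₄²-b₂b₆] β (b₄ W) (b₆ W) (b₈ W) ⟩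
  Δᵇ W * + 1728 + + 432 * β ^ 2 * (+ 4 * b₈ W + b₄ W ^ 2 - β * b₆ W)
    ≡⟨ cong (λ e → Δᵇ W * + 1728 + + 432 * β ^ 2 * (e - β * b₆ W)) (4b₈+b₄²≡b₂b₆ W) ⟩
  Δᵇ W * + 1728 + + 432 * β ^ 2 * (β * b₆ W - β * b₆ W)
    ≡⟨ solve 3 (λ δ β b₆ → δ :* con (+ 1728) :+ con (+ 432) :* β :^ 2 :* (β :* b₆ :- β :* b₆)
                          := δ :* con (+ 1728)) refl (Δᵇ W) β (b₆ W) ⟩
  Δᵇ W * + 1728 ∎
  where
  β = b₂ (rmm W)

Δ≡Δᵇ : ∀ W → Δ W ≡ Δᵇ W
Δ≡Δᵇ W = /ℕ-exact (c₄ W ^ 3 - c₆ W ^ 2) (Δᵇ W) 1728 (c₄³-c₆²≡1728Δᵇ W)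

c₄≡b₂²-mod : ∀ {d} W → d ℕ.∣ 24 → c₄ W ≡ b₂ (rmm W) ^ 2 mod d
c₄≡b₂²-mod {d} W (ℕ.divides q 24≡qd) = congruent (- (+ q * b₄ W)) (begin
  c₄ W                       ≡⟨ c₄≡b₂²-24b₄ W ⟩
  β ^ 2 - + 24 * b₄ W        ≡⟨ cong (λ m → β ^ 2 - m * b₄ W) (trans (cong +_ 24≡qd) (pos-* q d)) ⟩
  β ^ 2 - + q * + d * b₄ W   ≡⟨ solve 4 (λ β q d b₄ → β :^ 2 :- q :* d :* b₄ := β :^ 2 :+ (:- (q :* b₄)) :* d)
                                  refl β (+ q) (+ d) (b₄ W) ⟩
  β ^ 2 + - (+ q * b₄ W) * + d ∎)
  where
  β = b₂ (rmm W)

Δ≡a₃⁴-mod-2 : ∀ a₂ a₃ a₄ a₆ → Δ (mkW (+ 0) a₂ a₃ a₄ a₆) ≡ a₃ ^ 4 mod 2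
Δ≡a₃⁴-mod-2 a₂ a₃ a₄ a₆ = congruent
  (- + 8 * a₂ ^ 2 * b₈ W - + 32 * a₄ ^ 3 - + 14 * a₃ ^ 4 - + 108 * a₃ ^ 2 * a₆ - + 216 * a₆ ^ 2 + + 36 * a₂ * a₄ * b₆ W)
  (trans (Δ≡Δᵇ W) (solve 5 (λ a₂ a₃ a₄ a₆ b₈ →
      :- (con (+ 0) :^ 2 :+ con (+ 4) :* a₂) :^ 2 :* b₈ :- con (+ 8) :* (con (+ 2) :* a₄ :+ con (+ 0) :* a₃) :^ 3
        :- con (+ 27) :* (a₃ :^ 2 :+ con (+ 4) :* a₆) :^ 2
        :+ con (+ 9) :* (con (+ 0) :^ 2 :+ con (+ 4) :* a₂) :* (con (+ 2) :* a₄ :+ con (+ 0) :* a₃) :* (a₃ :^ 2 :+ con (+ 4) :* a₆)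
    := a₃ :^ 4 :+ (:- con (+ 8) :* a₂ :^ 2 :* b₈ :- con (+ 32) :* a₄ :^ 3 :- con (+ 14) :* a₃ :^ 4
                   :- con (+ 108) :* a₃ :^ 2 :* a₆ :- con (+ 216) :* a₆ :^ 2 :+ con (+ 36) :* a₂ :* a₄ :* (a₃ :^ 2 :+ con (+ 4) :* a₆))
         :* con (+ 2))
    refl a₂ a₃ a₄ a₆ (b₈ W)))
  where
  W = mkW (+ 0) a₂ a₃ a₄ a₆

multiplicative⇒∤b₂² : ∀ {p} W → p ℕ.∣ 24 → MultiplicativeAt p W → ¬ + p ∣ b₂ (rmm W) ^ 2
multiplicative⇒∤b₂² W p∣24 (_ , p∤c₄) = p∤c₄ ∘ from (∣-resp-≡-mod (c₄≡b₂²-mod W p∣24))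

additive⇒∣b₂² : ∀ {p} W → p ℕ.∣ 24 → AdditiveAt p W → + p ∣ b₂ (rmm W) ^ 2
additive⇒∣b₂² W p∣24 (p∣c₄ , _) = to (∣-resp-≡-mod (c₄≡b₂²-mod W p∣24)) p∣c₄

good⇒a₁≡0⇒2∤a₃⁴ : ∀ W → GoodAt 2 W → a₁ W ≡ + 0 → ¬ + 2 ∣ a₃ W ^ 4
good⇒a₁≡0⇒2∤a₃⁴ (mkW _ a₂ a₃ a₄ a₆) 2∤Δ refl = 2∤Δ ∘ from (∣-resp-≡-mod (Δ≡a₃⁴-mod-2 a₂ a₃ a₄ a₆))

additive⇒a₁≡0⇒2∣a₃⁴ : ∀ W → AdditiveAt 2 W → a₁ W ≡ + 0 → + 2 ∣ a₃ W ^ 4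
additive⇒a₁≡0⇒2∣a₃⁴ (mkW _ a₂ a₃ a₄ a₆) (_ , 2∣Δ) refl = to (∣-resp-≡-mod (Δ≡a₃⁴-mod-2 a₂ a₃ a₄ a₆)) 2∣Δ

reducedTriples : List Triple
reducedTriples =
  cartesianProduct (+ 0 ∷ + 1 ∷ []) (cartesianProduct (+ 0 ∷ -[1+ 0 ] ∷ + 1 ∷ []) (+ 0 ∷ + 1 ∷ []))

rmm∈reducedTriples : ∀ W → IsReduced W → rmm W ∈ reducedTriples
rmm∈reducedTriples _ (a₁∈ , a₂∈ , a₃∈) =
  ∈-cartesianProduct⁺ (zero-or-one a₁∈) (∈-cartesianProduct⁺ (zero-or-±one a₂∈) (zero-or-one a₃∈))
  where
  zero-or-one : ∀ {x} → x ≡ + 0 ⊎ x ≡ + 1 → x ∈ + 0 ∷ + 1 ∷ []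
  zero-or-one = [ here , there ∘ here ]′
  zero-or-±one : ∀ {x} → x ≡ -[1+ 0 ] ⊎ (x ≡ + 0 ⊎ x ≡ + 1) → x ∈ + 0 ∷ -[1+ 0 ] ∷ + 1 ∷ []
  zero-or-±one = [ there ∘ here , [ here , there ∘ there ∘ here ]′ ]′

theoremB : (W : Weierstrass) → IsReducedMinimalModel W →
    ((GoodAt 2 W → rmm W ∈ R₂ ∷ R₄ ∷ R₆ ∷ R₇ ∷ R₈ ∷ R₉ ∷ R₁₀ ∷ R₁₁ ∷ R₁₂ ∷ [])
     × (GoodAt 3 W → rmm W ∈ R₁ ∷ R₂ ∷ R₃ ∷ R₄ ∷ R₅ ∷ R₆ ∷ R₇ ∷ R₈ ∷ R₉ ∷ R₁₀ ∷ R₁₁ ∷ R₁₂ ∷ []))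
    × ((MultiplicativeAt 2 W → rmm W ∈ R₇ ∷ R₈ ∷ R₉ ∷ R₁₀ ∷ R₁₁ ∷ R₁₂ ∷ [])
     × (MultiplicativeAt 3 W → rmm W ∈ R₃ ∷ R₄ ∷ R₅ ∷ R₆ ∷ R₇ ∷ R₈ ∷ R₁₁ ∷ R₁₂ ∷ []))
    × ((AdditiveAt 2 W → rmm W ∈ R₁ ∷ R₃ ∷ R₅ ∷ [])
     × (AdditiveAt 3 W → rmm W ∈ R₁ ∷ R₂ ∷ R₉ ∷ R₁₀ ∷ []))
theoremB W (_ , _ , reduced) =
    ( rmm∈-filter (λ (a₁ , _ , a₃) → (a₁ ≟ + 0) →-dec ¬? (+ 2 ∣? a₃ ^ 4)) (good⇒a₁≡0⇒2∤a₃⁴ W)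
    , λ _ → rmm∈reducedTriples W reduced )
  , ( rmm∈-filter (λ t → ¬? (+ 2 ∣? b₂ t ^ 2)) (multiplicative⇒∤b₂² W 2∣24)
    , rmm∈-filter (λ t → ¬? (+ 3 ∣? b₂ t ^ 2)) (multiplicative⇒∤b₂² W 3∣24) )
  , ( rmm∈-filter (λ t@(a₁ , _ , a₃) → (+ 2 ∣? b₂ t ^ 2) ×-dec ((a₁ ≟ + 0) →-dec (+ 2 ∣? a₃ ^ 4)))
           (λ add → additive⇒∣b₂² W 2∣24 add , additive⇒a₁≡0⇒2∣a₃⁴ W add)
    , rmm∈-filter (λ t → + 3 ∣? b₂ t ^ 2) (additive⇒∣b₂² W 3∣24) )
  where
  2∣24 : 2 ℕ.∣ 24
  2∣24 = ℕ.divides 12 refl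
  3∣24 : 3 ℕ.∣ 24
  3∣24 = ℕ.divides 8 refl
  -- filter P? reducedTriples evaluates to the stated list of Rᵢ, so the types agree by computation.
  rmm∈-filter : ∀ {P : Triple → Set} {A : Set} (P? : Decidable P) →
                (A → P (rmm W)) → A → rmm W ∈ filter P? reducedTriples
  rmm∈-filter P? A⇒P = ∈-filter⁺ P? (rmm∈reducedTriples W reduced) ∘ A⇒P
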